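{- The linearity degree of Keedwell Sudoku boards is invariant under $G_k$: if $B$ is a Keedwell board and $g\in G_k$, then $g\cdot B$ is a Keedwell board with the same linearity degree as $B$.
   Context: A Sudoku board is a $9\times 9$ grid with nine symbols such that each row, column and designated $3\times 3$ block (subsquare) contains each symbol once; subsquares are indexed $(i,j)$, $i,j\in\{0,1,2\}$, with $(0,0)$ the upper-left one. For a $3\times 3$ array, let $\alpha$ cyclically shift its rows down by one and $\beta$ cyclically shift its columns right by one. A Sudoku board $B$ with upper-left subsquare $K$ is Keedwell if there are exponents $c_{ij},d_{ij}\in\mathbb{Z}/3\mathbb{Z}$ with $c_{00}=d_{00}=0$ such that the $(i,j)$ subsquare of $B$ equals $\alpha^{c_{ij}}\beta^{d_{ij}}K$ for all $i,j$ (these exponent matrices are uniquely determined since $K$ has nine distinct entries). A matrix $(m_{ij})_{0\le i,j\le 2}$ over $\mathbb{Z}/3\mathbb{Z}$ is quasi-linear if $m_{ij}=m_{i0}+m_{0j}$ for all $i,j$. The linearity degree of a Keedwell board is the number (0, 1 or 2) of its two exponent matrices $(c_{ij})$, $(d_{ij})$ that are quasi-linear. Let $H_9$ be the group of cell permutations generated by permutations of bands, of pillars, of rows within a band, of columns within a pillar, and transpose; $S_9$ the group of all relabelings of the symbols; $G_9=H_9\times S_9$. $G_k$ is the largest subgroup of $G_9$ all of whose elements map Keedwell boards to Keedwell boards. -}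

module Defs where

open import Data.Nat using (ℕ; zero; suc; _+_)
open import Data.Fin using (Fin; zero; suc; toℕ; _≟_)
open import Data.Fin.Properties using (all?)
open import Data.Fin.Permutation using (Permutation′; _⟨$⟩ʳ_; _⟨$⟩ˡ_)
open import Data.Bool using (Bool; true; false; if_then_else_)
open import Data.List using (List; []; _∷_)
open import Data.Product using (_×_; _,_; proj₁; proj₂; Σ; ∃; ∃!)
open import Relation.Binary.PropositionalEquality using (_≡_)
open import Relation.Nullary using (Dec; yes; no)
open import Relation.Nullary.Decidable using (⌊_⌋)
open import Function using (_∘_; id)
open import Function.Bundles using (_↔_; Inverse)
open import Function.Construct.Identity using (↔-id)
open import Function.Construct.Composition using (_↔-∘_)
open import Function.Construct.Symmetry using (↔-sym)

ℤ₃ : Set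
ℤ₃ = Fin 3

_+₃_ : ℤ₃ → ℤ₃ → ℤ₃
zero +₃ b = b
suc zero +₃ zero = suc zero
suc zero +₃ suc zero = suc (suc zero)
suc zero +₃ suc (suc zero) = zero
suc (suc zero) +₃ zero = suc (suc zero)
suc (suc zero) +₃ suc zero = zero
suc (suc zero) +₃ suc (suc zero) = suc zero

pred₃ : ℤ₃ → ℤ₃
pred₃ zero = suc (suc zero)
pred₃ (suc zero) = zero
pred₃ (suc (suc zero)) = suc zero

-- Boards.  Row index r = 3*i + a is represented by the pair (i , a):
-- i = band (block row), a = row inside the band.  Likewise columns
-- (j , b): j = pillar, b = column inside the pillar.

Symbol : Set
Symbol = Fin 9

Row : Set
Row = Fin 3 × Fin 3

Col : Set
Col = Fin 3 × Fin 3

Cell : Set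
Cell = Row × Col

Board : Set
Board = Cell → Symbol

record IsSudoku (B : Board) : Set where
  field
    rows   : ∀ (r : Row) (s : Symbol) → ∃! _≡_ (λ (c : Col) → B (r , c) ≡ s)
    cols   : ∀ (c : Col) (s : Symbol) → ∃! _≡_ (λ (r : Row) → B (r , c) ≡ s)
    blocks : ∀ (i j : Fin 3) (s : Symbol) →
             ∃! _≡_ (λ (ab : Fin 3 × Fin 3) → B ((i , proj₁ ab) , (j , proj₂ ab)) ≡ s)

Array3 : Set
Array3 = Fin 3 → Fin 3 → Symbol

subsquare : Board → Fin 3 → Fin 3 → Array3
subsquare B i j a b = B ((i , a) , (j , b))

α : Array3 → Array3
α K a b = K (pred₃ a) b

β : Array3 → Array3
β K a b = K a (pred₃ b)

_^[_] : {A : Set} → (A → A) → ℕ → A → A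
f ^[ zero ] = id
f ^[ suc n ] = f ∘ (f ^[ n ])

shift : ℤ₃ → ℤ₃ → Array3 → Array3
shift c d K = (α ^[ toℕ c ]) ((β ^[ toℕ d ]) K)

Matrix3 : Set
Matrix3 = Fin 3 → Fin 3 → ℤ₃

KeedwellWitness : Board → Matrix3 → Matrix3 → Set
KeedwellWitness B c d =
  (c zero zero ≡ zero) × (d zero zero ≡ zero) ×
  (∀ (i j a b : Fin 3) →
     subsquare B i j a b ≡ shift (c i j) (d i j) (subsquare B zero zero) a b)

IsKeedwell : Board → Set
IsKeedwell B = IsSudoku B × ∃ λ (c : Matrix3) → ∃ λ (d : Matrix3) → KeedwellWitness B c d

QuasiLinear : Matrix3 → Set
QuasiLinear m = ∀ (i j : Fin 3) → m i j ≡ (m i zero +₃ m zero j)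

quasiLinear? : (m : Matrix3) → Dec (QuasiLinear m)
quasiLinear? m = all? (λ i → all? (λ j → m i j ≟ (m i zero +₃ m zero j)))

linearityDegree : Matrix3 → Matrix3 → ℕ
linearityDegree c d =
  (if ⌊ quasiLinear? c ⌋ then 1 else 0) + (if ⌊ quasiLinear? d ⌋ then 1 else 0)

Perm3 : Set
Perm3 = Permutation′ 3

data Gen : Set where
  bandPerm   : Perm3 → Gen
  pillarPerm : Perm3 → Gen
  rowPerm    : Fin 3 → Perm3 → Gen
  colPerm    : Fin 3 → Perm3 → Gen
  transpose  : Gen

app : Bool → Perm3 → Fin 3 → Fin 3
app true  π x = π ⟨$⟩ʳ x
app false π x = π ⟨$⟩ˡ x

-- action of a generator (true) or of its inverse (false) on cells
genFun : Bool → Gen → Cell → Cell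
genFun f (bandPerm π)   ((i , a) , c) = ((app f π i , a) , c)
genFun f (pillarPerm π) (r , (j , b)) = (r , (app f π j , b))
genFun f (rowPerm k π)  ((i , a) , c) =
  ((i , (if ⌊ i ≟ k ⌋ then app f π a else a)) , c)
genFun f (colPerm k π)  (r , (j , b)) =
  (r , (j , (if ⌊ j ≟ k ⌋ then app f π b else b)))
genFun f transpose      (r , c) = (c , r)

evalWord : List (Bool × Gen) → Cell → Cell
evalWord [] = id
evalWord ((f , g) ∷ ws) = genFun f g ∘ evalWord ws

InH₉ : (Cell ↔ Cell) → Set
InH₉ h = ∃ λ (ws : List (Bool × Gen)) → ∀ x → Inverse.to h x ≡ evalWord ws x

-- elements of the ambient group Sym(cells) × Sym(symbols)
GElt : Set
GElt = (Cell ↔ Cell) × (Symbol ↔ Symbol)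

InG₉ : GElt → Set
InG₉ (h , σ) = InH₉ h

gid : GElt
gid = (↔-id Cell , ↔-id Symbol)

_·ᵍ_ : GElt → GElt → GElt
(h , σ) ·ᵍ (h' , σ') = (h ↔-∘ h' , σ ↔-∘ σ')

ginv : GElt → GElt
ginv (h , σ) = (↔-sym h , ↔-sym σ)

act : GElt → Board → Board
act (h , σ) B x = Inverse.to σ (B (Inverse.from h x))

record IsSubgroupOfG₉ (S : GElt → Set) : Set where
  field
    ⊆G₉    : ∀ g → S g → InG₉ g
    hasId  : S gid
    closed : ∀ g g' → S g → S g' → S (g ·ᵍ g')
    inv    : ∀ g → S g → S (ginv g)

PreservesKeedwell : GElt → Set
PreservesKeedwell g = ∀ B → IsKeedwell B → IsKeedwell (act g B)

-- G_k : the largest subgroup of G₉ all of whose elements map Keedwell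
-- boards to Keedwell boards; g ∈ G_k iff g lies in some subgroup of G₉
-- all of whose elements preserve Keedwell boards (the union of all such
-- subgroups is that largest subgroup).
InGk : GElt → Set₁
InGk g = ∃ λ (S : GElt → Set) →
  IsSubgroupOfG₉ S × (∀ h → S h → PreservesKeedwell h) × S g

module Submission where

-- Two rows of a board "meet in pillar j" if they share a symbol there; a
-- board is row-coherent if rows meeting in one pillar meet in every
-- pillar, and column-coherent if its transpose is row-coherent.  In a
-- Keedwell board with exponents (c, d) the rows of subsquare (i, j) are
-- rows of the upper-left block K shifted by c i j, so rows meet in pillar
-- j iff they show the same row of K there; arithmetic in ℤ₃ turns this into
--   c quasi-linear ⇔ row-coherent,   d quasi-linear ⇔ column-coherent.
-- Relabelling symbols and the row generators of H₉ preserve both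
-- properties, column generators are row generators conjugated by
-- transposition, and transposition swaps them.  Hence every g ∈ G₉
-- preserves or swaps the pair, and with it the linearity degree; that
-- g · B is Keedwell is the defining property of G_k.

open import Defs
open import Data.Product using (_×_)
open import Relation.Binary.PropositionalEquality using (_≡_)

open import Data.Nat using (ℕ; zero; suc; _+_)
open import Data.Nat.Properties using (+-comm)
open import Data.Bool using (true; false; if_then_else_)
open import Data.Fin using (Fin; zero; toℕ; _≟_)
open import Data.Fin.Properties using (all?)
open import Data.Fin.Permutation using (_⟨$⟩ʳ_; _⟨$⟩ˡ_; inverseʳ; inverseˡ)
open import Data.List using ([]; _∷_)
open import Data.Product using (∃; _,_; proj₁; swap)
open import Data.Sum using (_⊎_; inj₁; inj₂)
open import Function using (_∘_; flip)
open import Function.Bundles using (_⇔_; _↔_; mk⇔; Equivalence; Inverse; Injection)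
open import Function.Definitions using (Injective; StrictlySurjective)
open import Function.Properties.Inverse using (↔⇒↣)
import Function.Properties.Equivalence as ⇔
open import Relation.Binary.PropositionalEquality
  using (refl; sym; trans; cong; cong₂; module ≡-Reasoning)
open import Relation.Nullary.Decidable
  using (Dec; ⌊_⌋; from-yes; _→-dec_; does-⇔; isYes≗does)

open Equivalence using (to; from)

-- a ⊖ c is a - c in ℤ₃, realised as the c-fold predecessor, which is
-- exactly how the shifts α, β move indices.
_⊖_ : ℤ₃ → ℤ₃ → ℤ₃
a ⊖ c = (pred₃ ^[ toℕ c ]) a

+₃-comm : ∀ x y → x +₃ y ≡ y +₃ x
+₃-comm = from-yes (all? λ x → all? λ y → x +₃ y ≟ y +₃ x)

⊖-+ : ∀ a x y → a ⊖ (x +₃ y) ≡ (a ⊖ x) ⊖ y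
⊖-+ = from-yes (all? λ a → all? λ x → all? λ y → a ⊖ (x +₃ y) ≟ (a ⊖ x) ⊖ y)

⊖-self : ∀ a → a ⊖ a ≡ zero
⊖-self = from-yes (all? λ a → a ⊖ a ≟ zero)

⊖-cancelʳ : ∀ y u v → u ⊖ y ≡ v ⊖ y → u ≡ v
⊖-cancelʳ = from-yes (all? λ y → all? λ u → all? λ v → (u ⊖ y ≟ v ⊖ y) →-dec (u ≟ v))

⊖-solve : ∀ x y z → x ⊖ y ≡ zero ⊖ z → y ≡ x +₃ z
⊖-solve = from-yes (all? λ x → all? λ y → all? λ z → (x ⊖ y ≟ zero ⊖ z) →-dec (y ≟ x +₃ z))

iterate-comm : {A : Set} (f : A → A) (n : ℕ) (x : A) → (f ^[ n ]) (f x) ≡ f ((f ^[ n ]) x)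
iterate-comm f zero x = refl
iterate-comm f (suc n) x = cong f (iterate-comm f n x)

α-iterate : ∀ n (K : Array3) a b → (α ^[ n ]) K a b ≡ K ((pred₃ ^[ n ]) a) b
α-iterate zero K a b = refl
α-iterate (suc n) K a b =
  trans (α-iterate n K (pred₃ a) b) (cong (λ a' → K a' b) (iterate-comm pred₃ n a))

β-iterate : ∀ n (K : Array3) a b → (β ^[ n ]) K a b ≡ K a ((pred₃ ^[ n ]) b)
β-iterate zero K a b = refl
β-iterate (suc n) K a b =
  trans (β-iterate n K a (pred₃ b)) (cong (K a) (iterate-comm pred₃ n b))

shift-entry : ∀ c d (K : Array3) a b → shift c d K a b ≡ K (a ⊖ c) (b ⊖ d)
shift-entry c d K a b =
  trans (α-iterate (toℕ c) ((β ^[ toℕ d ]) K) a b) (β-iterate (toℕ d) K (a ⊖ c) b)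

_ᵀ : Board → Board
(X ᵀ) (r , c) = X (c , r)

AllOrNone : {I : Set} → (I → Set) → Set
AllOrNone P = ∀ i i' → P i → P i'

RowsMeet : Board → Row → Row → Fin 3 → Set
RowsMeet X r r' j = ∃ λ b → ∃ λ b' → X (r , (j , b)) ≡ X (r' , (j , b'))

RowCoherent : Board → Set
RowCoherent X = ∀ r r' → AllOrNone (RowsMeet X r r')

ColCoherent : Board → Set
ColCoherent X = RowCoherent (X ᵀ)

SameProfile : Board → Board → Set
SameProfile Y X = (RowCoherent Y ⇔ RowCoherent X) × (ColCoherent Y ⇔ ColCoherent X)

-- Y agrees with X, or with X with the two properties exchanged
-- (note ColCoherent (X ᵀ) is RowCoherent X, as X ᵀ ᵀ is X).
Related : Board → Board → Set
Related Y X = SameProfile Y X ⊎ SameProfile Y (X ᵀ)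

∀₂-cong : {A B : Set} {P Q : A → B → Set} →
  (∀ a b → P a b ⇔ Q a b) → (∀ a b → P a b) ⇔ (∀ a b → Q a b)
∀₂-cong e = mk⇔ (λ h a b → to (e a b) (h a b)) (λ h a b → from (e a b) (h a b))

∀₂-surjective : {A B : Set} (f : A → B) → StrictlySurjective _≡_ f → (P : B → B → Set) →
  (∀ b b' → P b b') ⇔ (∀ a a' → P (f a) (f a'))
∀₂-surjective f surj P = mk⇔ (λ h a a' → h (f a) (f a')) backward
  where
  backward : (∀ a a' → P (f a) (f a')) → ∀ b b' → P b b'
  backward h b b' with surj b | surj b'
  ... | a , refl | a' , refl = h a a'

allOrNone-cong : {I : Set} {P Q : I → Set} → (∀ i → P i ⇔ Q i) → AllOrNone P ⇔ AllOrNone Q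
allOrNone-cong e = ∀₂-cong λ i i' →
  mk⇔ (λ h → to (e i') ∘ h ∘ from (e i)) (λ h → from (e i') ∘ h ∘ to (e i))

allOrNone-reindex : {I J : Set} (f : J → I) → StrictlySurjective _≡_ f → (P : I → Set) →
  AllOrNone P ⇔ AllOrNone (P ∘ f)
allOrNone-reindex f surj P = ∀₂-surjective f surj (λ i i' → P i → P i')

rowCoherent-cong : {Y X : Board} →
  (∀ r r' j → RowsMeet Y r r' j ⇔ RowsMeet X r r' j) → RowCoherent Y ⇔ RowCoherent X
rowCoherent-cong e = ∀₂-cong λ r r' → allOrNone-cong (e r r')

sameProfile-refl : {X : Board} → SameProfile X X
sameProfile-refl = ⇔.refl , ⇔.refl

sameProfile-trans : {X Y Z : Board} → SameProfile X Y → SameProfile Y Z → SameProfile X Z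
sameProfile-trans (rows , cols) (rows' , cols') = ⇔.trans rows rows' , ⇔.trans cols cols'

sameProfile-ᵀ : {Y X : Board} → SameProfile Y X → SameProfile (Y ᵀ) (X ᵀ)
sameProfile-ᵀ = swap

related-trans : {X Y Z : Board} → Related X Y → Related Y Z → Related X Z
related-trans (inj₁ p) (inj₁ q) = inj₁ (sameProfile-trans p q)
related-trans (inj₁ p) (inj₂ q) = inj₂ (sameProfile-trans p q)
related-trans (inj₂ p) (inj₁ q) = inj₂ (sameProfile-trans p (sameProfile-ᵀ q))
related-trans (inj₂ p) (inj₂ q) = inj₁ (sameProfile-trans p (sameProfile-ᵀ q))

bandwise : (Fin 3 → Fin 3) → (Fin 3 → Fin 3 → Fin 3) → Row → Row
bandwise p q (i , a) = (p i , q i a)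

bandwise-surjective : {p : Fin 3 → Fin 3} {q : Fin 3 → Fin 3 → Fin 3} →
  StrictlySurjective _≡_ p → (∀ i → StrictlySurjective _≡_ (q i)) →
  StrictlySurjective _≡_ (bandwise p q)
bandwise-surjective sp sq (i , a) with sp i
... | i₀ , refl with sq i₀ a
... | a₀ , refl = (i₀ , a₀) , refl

permuteRows : Board → (Row → Row) → Board
permuteRows X ρ (r , c) = X (ρ r , c)

-- band i of the permuted board consists of the rows of band p i of X,
-- so columns meet there exactly when they meet in band p i of X
colsMeet-bandwise : {p : Fin 3 → Fin 3} {q : Fin 3 → Fin 3 → Fin 3} (X : Board) →
  (∀ i → StrictlySurjective _≡_ (q i)) → ∀ c c' i →
  RowsMeet (permuteRows X (bandwise p q) ᵀ) c c' i ⇔ RowsMeet (X ᵀ) c c' (p i)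
colsMeet-bandwise {p} {q} X sq c c' i = mk⇔ (λ (a , a' , e) → q i a , q i a' , e) backward
  where
  backward : RowsMeet (X ᵀ) c c' (p i) → RowsMeet (permuteRows X (bandwise p q) ᵀ) c c' i
  backward (a , a' , e) with sq i a | sq i a'
  ... | a₀ , refl | a₀' , refl = a₀ , a₀' , e

bandwise-sameProfile : {p : Fin 3 → Fin 3} {q : Fin 3 → Fin 3 → Fin 3} (X : Board) →
  StrictlySurjective _≡_ p → (∀ i → StrictlySurjective _≡_ (q i)) →
  SameProfile X (permuteRows X (bandwise p q))
bandwise-sameProfile {p} {q} X sp sq = rows , cols
  where
  rows : RowCoherent X ⇔ RowCoherent (permuteRows X (bandwise p q))
  rows = ∀₂-surjective (bandwise p q) (bandwise-surjective sp sq)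
           (λ r r' → AllOrNone (RowsMeet X r r'))
  cols : ColCoherent X ⇔ ColCoherent (permuteRows X (bandwise p q))
  cols = ∀₂-cong λ c c' →
    ⇔.trans (allOrNone-reindex p sp (RowsMeet (X ᵀ) c c'))
            (⇔.sym (allOrNone-cong (colsMeet-bandwise X sq c c')))

id-surjective : StrictlySurjective _≡_ (λ (a : Fin 3) → a)
id-surjective a = a , refl

app-surjective : ∀ f π → StrictlySurjective _≡_ (app f π)
app-surjective true π y = π ⟨$⟩ˡ y , inverseʳ π
app-surjective false π y = π ⟨$⟩ʳ y , inverseˡ π

if-surjective : ∀ b {f : Fin 3 → Fin 3} → StrictlySurjective _≡_ f →
  StrictlySurjective _≡_ (λ a → if b then f a else a)
if-surjective true surj = surj
if-surjective false surj = id-surjective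

-- The row generators are bandwise row maps; the column generators are the
-- same maps conjugated by transposition.
bandPerm-sameProfile : ∀ f π (Z : Board) → SameProfile Z (λ x → Z (genFun f (bandPerm π) x))
bandPerm-sameProfile f π Z =
  bandwise-sameProfile Z (app-surjective f π) (λ _ → id-surjective)

rowPerm-sameProfile : ∀ f k π (Z : Board) → SameProfile Z (λ x → Z (genFun f (rowPerm k π) x))
rowPerm-sameProfile f k π Z =
  bandwise-sameProfile Z id-surjective (λ i → if-surjective ⌊ i ≟ k ⌋ (app-surjective f π))

-- transposition exchanges the coherence properties outright
generator-related : ∀ f g (Z : Board) → Related Z (λ x → Z (genFun f g x))
generator-related f (bandPerm π) Z = inj₁ (bandPerm-sameProfile f π Z)
generator-related f (rowPerm k π) Z = inj₁ (rowPerm-sameProfile f k π Z)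
generator-related f (pillarPerm π) Z = inj₁ (sameProfile-ᵀ (bandPerm-sameProfile f π (Z ᵀ)))
generator-related f (colPerm k π) Z = inj₁ (sameProfile-ᵀ (rowPerm-sameProfile f k π (Z ᵀ)))
generator-related f transpose Z = inj₂ sameProfile-refl

word-related : ∀ ws (Z : Board) → Related Z (λ x → Z (evalWord ws x))
word-related [] Z = inj₁ sameProfile-refl
word-related ((f , g) ∷ ws) Z =
  related-trans (generator-related f g Z) (word-related ws (λ x → Z (genFun f g x)))

relabel-sameProfile : {Y X : Board} {σ : Symbol → Symbol} → Injective _≡_ _≡_ σ →
  (∀ x → Y x ≡ σ (X x)) → SameProfile Y X
relabel-sameProfile {σ = σ} σ-inj relabel =
  rowCoherent-cong (meet relabel) , rowCoherent-cong (meet λ (r , c) → relabel (c , r))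
  where
  meet : {Y X : Board} → (∀ x → Y x ≡ σ (X x)) →
    ∀ r r' j → RowsMeet Y r r' j ⇔ RowsMeet X r r' j
  meet eq r r' j = mk⇔
    (λ (b , b' , e) → b , b' , σ-inj (trans (sym (eq _)) (trans e (eq _))))
    (λ (b , b' , e) → b , b' , trans (eq _) (trans (cong σ e) (sym (eq _))))

act-related : (B : Board) (h : Cell ↔ Cell) (σ : Symbol ↔ Symbol) →
  InH₉ h → Related (act (h , σ) B) B
act-related B h σ (ws , h≗ws) =
  related-trans (word-related ws B')
                (inj₁ (relabel-sameProfile (Injection.injective (↔⇒↣ σ)) moved))
  where
  B' : Board
  B' = act (h , σ) B
  moved : ∀ x → B' (evalWord ws x) ≡ Inverse.to σ (B x)
  moved x = cong (Inverse.to σ ∘ B)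
    (trans (cong (Inverse.from h) (sym (h≗ws x))) (Inverse.strictlyInverseʳ h x))

Injective₂ : Array3 → Set
Injective₂ L = ∀ {a b a' b'} → L a b ≡ L a' b' → a ≡ a' × b ≡ b'

subsquare-injective : {B : Board} → IsSudoku B → ∀ i j → Injective₂ (subsquare B i j)
subsquare-injective {B} sud i j {a} {b} {a'} {b'} e
  with IsSudoku.blocks sud i j (subsquare B i j a' b')
... | _ , _ , unique with trans (sym (unique e)) (unique refl)
... | refl = refl , refl

ShiftedCopies : Board → Array3 → Matrix3 → Matrix3 → Set
ShiftedCopies X L m n = ∀ i j a b → X ((i , a) , (j , b)) ≡ L (a ⊖ m i j) (b ⊖ n i j)

keedwell-shiftedCopies : {B : Board} {c d : Matrix3} →
  KeedwellWitness B c d → ShiftedCopies B (subsquare B zero zero) c d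
keedwell-shiftedCopies {B} {c} {d} (_ , _ , copies) i j a b =
  trans (copies i j a b) (shift-entry (c i j) (d i j) (subsquare B zero zero) a b)

shiftedCopies-ᵀ : {X : Board} {L : Array3} {m n : Matrix3} →
  ShiftedCopies X L m n → ShiftedCopies (X ᵀ) (flip L) (flip n) (flip m)
shiftedCopies-ᵀ copies j i b a = copies i j a b

-- the row of the base block that row r shows in pillar j
rowShift : Matrix3 → Row → Fin 3 → ℤ₃
rowShift m (i , a) j = a ⊖ m i j

rowsMeet⇔sameShift : {X : Board} {L : Array3} {m n : Matrix3} →
  ShiftedCopies X L m n → Injective₂ L →
  ∀ r r' j → RowsMeet X r r' j ⇔ (rowShift m r j ≡ rowShift m r' j)
rowsMeet⇔sameShift {X} {L} {m} {n} copies L-inj (i , a) (i' , a') j = mk⇔ forward backward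
  where
  forward : RowsMeet X (i , a) (i' , a') j → a ⊖ m i j ≡ a' ⊖ m i' j
  forward (b , b' , e) =
    proj₁ (L-inj (trans (sym (copies i j a b)) (trans e (copies i' j a' b'))))
  backward : a ⊖ m i j ≡ a' ⊖ m i' j → RowsMeet X (i , a) (i' , a') j
  backward e = n i j , n i' j , (begin
    X ((i , a) , (j , n i j))          ≡⟨ copies i j a (n i j) ⟩
    L (a ⊖ m i j) (n i j ⊖ n i j)      ≡⟨ cong₂ L e sameColumn ⟩
    L (a' ⊖ m i' j) (n i' j ⊖ n i' j)  ≡⟨ sym (copies i' j a' (n i' j)) ⟩
    X ((i' , a') , (j , n i' j))       ∎)
    where
    open ≡-Reasoning
    sameColumn : n i j ⊖ n i j ≡ n i' j ⊖ n i' j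
    sameColumn = trans (⊖-self (n i j)) (sym (⊖-self (n i' j)))

ShiftCoherent : Matrix3 → Set
ShiftCoherent m = ∀ r r' → AllOrNone (λ j → rowShift m r j ≡ rowShift m r' j)

rowShift-split : {m : Matrix3} → QuasiLinear m → ∀ r j →
  rowShift m r j ≡ rowShift m r zero ⊖ m zero j
rowShift-split {m} ql (i , a) j = trans (cong (a ⊖_) (ql i j)) (⊖-+ a (m i zero) (m zero j))

quasiLinear⇒shiftCoherent : {m : Matrix3} → QuasiLinear m → ShiftCoherent m
quasiLinear⇒shiftCoherent {m} ql r r' j j' e = begin
  rowShift m r j'                 ≡⟨ split r j' ⟩
  rowShift m r zero ⊖ m zero j'   ≡⟨ cong (_⊖ m zero j') sameInPillar₀ ⟩
  rowShift m r' zero ⊖ m zero j'  ≡⟨ sym (split r' j') ⟩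
  rowShift m r' j'                ∎
  where
  open ≡-Reasoning
  split : ∀ r j → rowShift m r j ≡ rowShift m r zero ⊖ m zero j
  split = rowShift-split ql
  sameInPillar₀ : rowShift m r zero ≡ rowShift m r' zero
  sameInPillar₀ = ⊖-cancelʳ (m zero j) _ _ (trans (sym (split r j)) (trans e (split r' j)))

-- Conversely, row m i 0 of band i and row 0 of band 0 both show row 0 of
-- the base block in pillar 0, hence the same row in every pillar j.
shiftCoherent⇒quasiLinear : {m : Matrix3} → m zero zero ≡ zero → ShiftCoherent m → QuasiLinear m
shiftCoherent⇒quasiLinear {m} m₀₀ coherent i j =
  ⊖-solve (m i zero) (m i j) (m zero j)
    (coherent (i , m i zero) (zero , zero) zero j meetInPillar₀)
  where
  meetInPillar₀ : m i zero ⊖ m i zero ≡ zero ⊖ m zero zero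
  meetInPillar₀ = trans (⊖-self (m i zero)) (cong (zero ⊖_) (sym m₀₀))

shiftedCopies-rowCoherent : {X : Board} {L : Array3} {m n : Matrix3} →
  ShiftedCopies X L m n → Injective₂ L → m zero zero ≡ zero →
  RowCoherent X ⇔ QuasiLinear m
shiftedCopies-rowCoherent {X} {L} {m} {n} copies L-inj m₀₀ =
  ⇔.trans (∀₂-cong λ r r' → allOrNone-cong (rowsMeet⇔sameShift {X} {L} {m} {n} copies L-inj r r'))
          (mk⇔ (shiftCoherent⇒quasiLinear m₀₀) quasiLinear⇒shiftCoherent)

-- quasi-linearity is symmetric in the two indices, as ℤ₃ is commutative
quasiLinear-flip : {m : Matrix3} → QuasiLinear (flip m) ⇔ QuasiLinear m
quasiLinear-flip {m} = mk⇔
  (λ ql i j → trans (ql j i) (+₃-comm (m zero j) (m i zero)))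
  (λ ql j i → trans (ql i j) (+₃-comm (m i zero) (m zero j)))

keedwell-rowCoherent : {B : Board} (c d : Matrix3) → IsSudoku B →
  KeedwellWitness B c d → RowCoherent B ⇔ QuasiLinear c
keedwell-rowCoherent {B} c d sud w@(c₀₀ , _ , _) =
  shiftedCopies-rowCoherent {m = c} {n = d} (keedwell-shiftedCopies {B} {c} {d} w)
    (subsquare-injective sud zero zero) c₀₀

-- columns of B are rows of the transpose, a grid of copies shifted by flip d
keedwell-colCoherent : {B : Board} (c d : Matrix3) → IsSudoku B →
  KeedwellWitness B c d → ColCoherent B ⇔ QuasiLinear d
keedwell-colCoherent {B} c d sud w@(_ , d₀₀ , _) =
  ⇔.trans (shiftedCopies-rowCoherent {m = flip d} {n = flip c}
             (shiftedCopies-ᵀ {B} {subsquare B zero zero} {c} {d}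
               (keedwell-shiftedCopies {B} {c} {d} w))
             (swap ∘ subsquare-injective sud zero zero) d₀₀)
          quasiLinear-flip

keedwell-profile : {B : Board} (c d : Matrix3) → IsSudoku B → KeedwellWitness B c d →
  (RowCoherent B ⇔ QuasiLinear c) × (ColCoherent B ⇔ QuasiLinear d)
keedwell-profile c d sud w = keedwell-rowCoherent c d sud w , keedwell-colCoherent c d sud w

⌊⌋-⇔ : {A B : Set} → A ⇔ B → (a? : Dec A) (b? : Dec B) → ⌊ a? ⌋ ≡ ⌊ b? ⌋
⌊⌋-⇔ A⇔B a? b? = trans (isYes≗does a?) (trans (does-⇔ A⇔B a? b?) (sym (isYes≗does b?)))

degree-cong : {c d c' d' : Matrix3} →
  QuasiLinear c' ⇔ QuasiLinear c → QuasiLinear d' ⇔ QuasiLinear d →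
  linearityDegree c' d' ≡ linearityDegree c d
degree-cong {c} {d} {c'} {d'} ec ed =
  cong₂ (λ x y → (if x then 1 else 0) + (if y then 1 else 0))
    {⌊ quasiLinear? c' ⌋} {⌊ quasiLinear? c ⌋} {⌊ quasiLinear? d' ⌋} {⌊ quasiLinear? d ⌋}
    (⌊⌋-⇔ ec (quasiLinear? c') (quasiLinear? c)) (⌊⌋-⇔ ed (quasiLinear? d') (quasiLinear? d))

via : {A P Q B : Set} → P ⇔ A → P ⇔ Q → Q ⇔ B → A ⇔ B
via P⇔A P⇔Q Q⇔B = ⇔.trans (⇔.sym P⇔A) (⇔.trans P⇔Q Q⇔B)

-- related Keedwell boards have the same linearity degree; when the
-- relation swaps the coherence properties, it swaps the two summands
related-degree : {Y X : Board} (c d c' d' : Matrix3) → IsSudoku Y → IsSudoku X →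
  KeedwellWitness Y c' d' → KeedwellWitness X c d → Related Y X →
  linearityDegree c' d' ≡ linearityDegree c d
related-degree c d c' d' sudY sudX w' w related
  with keedwell-profile c' d' sudY w' | keedwell-profile c d sudX w | related
... | rowsY , colsY | rowsX , colsX | inj₁ (rows , cols) =
  degree-cong {c} {d} {c'} {d'} (via rowsY rows rowsX) (via colsY cols colsX)
... | rowsY , colsY | rowsX , colsX | inj₂ (rows , cols) = trans
  (degree-cong {d} {c} {c'} {d'} (via rowsY rows colsX) (via colsY cols rowsX))
  (+-comm (if ⌊ quasiLinear? d ⌋ then 1 else 0) (if ⌊ quasiLinear? c ⌋ then 1 else 0))

lemma4 : (B : Board) (g : GElt) → IsKeedwell B → InGk g →
    IsKeedwell (act g B) ×
    (∀ (c d c' d' : Matrix3) → KeedwellWitness B c d →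
      KeedwellWitness (act g B) c' d' →
      linearityDegree c' d' ≡ linearityDegree c d)
lemma4 B g@(h , σ) keedwell (_ , subgroup , preserves , g∈S) = keedwell' , sameDegree
  where
  keedwell' : IsKeedwell (act g B)
  keedwell' = preserves g g∈S B keedwell
  sameDegree : ∀ (c d c' d' : Matrix3) → KeedwellWitness B c d →
    KeedwellWitness (act g B) c' d' → linearityDegree c' d' ≡ linearityDegree c d
  sameDegree c d c' d' w w' = related-degree c d c' d' (proj₁ keedwell') (proj₁ keedwell) w' w
    (act-related B h σ (IsSubgroupOfG₉.⊆G₉ subgroup g g∈S))
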